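{- Let $p$ be an odd prime and let $G$ be a finite $2$-generator $p$-group of nilpotency class two. Then for all integers $s \ge 1$, $$M_i(G) = \begin{cases} \gamma_2(G)^{(p^s)}\, G^{(p^s)} & \text{if } 2p^{s-1}+1 \le i \le p^s,\\ \gamma_2(G)^{(p^s)}\, G^{(p^{s+1})} & \text{if } p^s+1 \le i \le 2p^s.\end{cases}$$
   Context: Commutators are $[x,y]=x^{ -1}y^{ -1}xy$; $\gamma_2(G) = [G,G]$. For a group $H$ and positive integer $n$, $H^{(n)}$ (also written $H^{n}$) is the subgroup generated by $\{h^n : h \in H\}$. The Brauer–Jennings–Zassenhaus series of a finite $p$-group $G$ is defined by $M_1(G) = G$ and $M_n(G) = [M_{n-1}(G), G]\, M_{\lceil n/p \rceil}(G)^{(p)}$ for $n \ge 2$. A group has nilpotency class two if $[[G,G],G]=1$ but $[G,G]\neq 1$. -}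

module Defs where

open import Level using (Level; _⊔_)
open import Data.Nat using (ℕ; zero; suc; _+_; _*_; _∸_; _≤_; _/_)
open import Data.Nat.Properties using (_≤?_)
open import Data.Fin using (Fin)
import Data.Nat
open import Data.Sum using (_⊎_)
open import Data.Product using (Σ; ∃; _×_; _,_)
open import Data.Unit.Polymorphic using (⊤)
open import Relation.Nullary using (¬_; yes; no)
open import Relation.Unary using (Pred)
open import Algebra.Bundles using (Group)
open import Relation.Binary.PropositionalEquality using (_≡_)

-- ⌈ n / p ⌉ (ceiling division); the value for p = 0 is irrelevant.
ceilDiv : ℕ → ℕ → ℕ
ceilDiv n zero    = zero
ceilDiv n (suc q) = (n + q) / suc q

module GroupDefs {c ℓ : Level} (G : Group c ℓ) where
  open Group G renaming (Carrier to A)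

  Subset : Set (Level.suc (c ⊔ ℓ))
  Subset = Pred A (c ⊔ ℓ)

  ⁅_,_⁆ : A → A → A
  ⁅ x , y ⁆ = ((x ⁻¹ ∙ y ⁻¹) ∙ x) ∙ y

  _^'_ : A → ℕ → A
  x ^' zero  = ε
  x ^' suc n = x ∙ (x ^' n)

  data ⟨_⟩ (S : Subset) : A → Set (c ⊔ ℓ) where
    gen  : ∀ {x} → S x → ⟨ S ⟩ x
    one  : ⟨ S ⟩ ε
    mul  : ∀ {x y} → ⟨ S ⟩ x → ⟨ S ⟩ y → ⟨ S ⟩ (x ∙ y)
    inv  : ∀ {x} → ⟨ S ⟩ x → ⟨ S ⟩ (x ⁻¹)
    resp : ∀ {x y} → x ≈ y → ⟨ S ⟩ x → ⟨ S ⟩ y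

  whole : Subset
  whole _ = ⊤

  comm : Subset → Subset → Subset
  comm H K = ⟨ (λ x → Σ A λ h → Σ A λ k → H h × K k × x ≈ ⁅ h , k ⁆) ⟩

  pow : Subset → ℕ → Subset
  pow H n = ⟨ (λ x → Σ A λ h → H h × x ≈ (h ^' n)) ⟩

  prod : Subset → Subset → Subset
  prod H K x = Σ A λ h → Σ A λ k → H h × K k × x ≈ (h ∙ k)

  _≐_ : Subset → Subset → Set (c ⊔ ℓ)
  H ≐ K = (∀ x → H x → K x) × (∀ x → K x → H x)

  γ₂ : Subset
  γ₂ = comm whole whole

  -- Brauer–Jennings–Zassenhaus series, by recursion with fuel:
  -- MAux f n computes M_n whenever n ≤ f (for p ≥ 2, since then ⌈n/p⌉ ≤ n-1 for n ≥ 2).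
  MAux : ℕ → ℕ → ℕ → Subset
  MAux p zero    n = whole
  MAux p (suc f) n with n ≤? 1
  ... | yes _ = whole
  ... | no  _ = prod (comm (MAux p f (n ∸ 1)) whole) (pow (MAux p f (ceilDiv n p)) p)

  -- M_n(G) for the prime p (M_1 = G; M_0 is not used)
  M : ℕ → ℕ → Subset
  M p n = MAux p n n

  HasOrder : ℕ → Set (c ⊔ ℓ)
  HasOrder n = Σ (Fin n → A) λ e →
    (∀ x → Σ (Fin n) λ i → e i ≈ x) × (∀ i j → e i ≈ e j → i ≡ j)

  IsFinitePGroup : ℕ → Set (c ⊔ ℓ)
  IsFinitePGroup p = Σ ℕ λ k → HasOrder (p Data.Nat.^ k)

  TwoGenerated : Set (c ⊔ ℓ)
  TwoGenerated = Σ A λ a → Σ A λ b → ∀ x → ⟨ (λ y → Level.Lift c ((y ≈ a) ⊎ (y ≈ b))) ⟩ x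

  ClassTwo : Set (c ⊔ ℓ)
  ClassTwo = (∀ x → comm γ₂ whole x → x ≈ ε) × (Σ A λ x → γ₂ x × ¬ (x ≈ ε))

-- In a group of class at most two commutators are central and [xy,g] = [x,g][y,g], whence
-- (xy)ⁿ = xⁿ yⁿ [y,x]^(n choose 2).  For odd p, p divides (p choose 2), so the p-th power of an
-- element of γ₂^(k)·G^(l) lies in γ₂^(pk)·G^(pl), while its commutators with G lie in γ₂^(l);
-- these products are subgroups because γ₂ is central.  Let a(n) and b(n) be the least exponents
-- with n ≤ 2pᵃ and n ≤ pᵇ.  Induction on n along M_n = [M_{n−1},G] M_{⌈n/p⌉}^(p) gives
-- M_n = γ₂^(p^a(n))·G^(p^b(n)): for ⊆ use a(n) ≤ b(n−1) and a(⌈n/p⌉) ≥ a(n) − 1,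
-- b(⌈n/p⌉) ≥ b(n) − 1; for ⊇ the generators of γ₂^(p^a) and G^(p^b) are p-th powers of elements
-- of M_{⌈n/p⌉}, except that γ₂ ⊆ [M_1,G] when n = 2.  The two ranges of the theorem are exactly
-- (a(i), b(i)) = (s, s) and (s, s + 1).

module Submission where

open import Defs
open import Level using (Level; _⊔_)
open import Data.Nat using (ℕ; zero; suc; _+_; _*_; _^_; _∸_; _≤_; _<_; z≤n; s≤s; s≤s⁻¹; nonTrivial⇒n>1)
open import Data.Nat.Properties
open import Data.Nat.DivMod using (_/_; m*n/n≡m; /-monoˡ-≤; m<n*o⇒m/o<n)
open import Data.Nat.Divisibility using (_∣_; divides; ∣-refl; 1∣_)
open import Data.Nat.Combinatorics using (_C_; nC1≡n; nCk+nC[k+1]≡[n+1]C[k+1])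
open import Data.Nat.Coprimality using (coprime-divisor; prime⇒coprime)
open import Data.Nat.Primality using (Prime; prime⇒nonTrivial; ¬prime[0]; ¬prime[1])
open import Data.Nat.Tactic.RingSolver using (solve-∀)
open import Data.Product using (Σ; _×_; _,_)
open import Data.Unit.Polymorphic using (⊤; tt)
open import Data.Empty using (⊥-elim)
open import Relation.Nullary using (¬_)
open import Relation.Unary using (_⊆_)
open import Relation.Binary.PropositionalEquality as ≡ using (_≡_; _≢_)
open import Algebra.Bundles using (Group)

-- Arithmetic

*<⇒<ceilDiv : ∀ {m n} d → m * suc d < n → m < ceilDiv n (suc d)
*<⇒<ceilDiv {m} {n} d m*p<n = begin
  suc m                   ≡⟨ m*n/n≡m (suc m) (suc d) ⟨
  suc m * suc d / suc d   ≤⟨ /-monoˡ-≤ (suc d) bound ⟩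
  (n + d) / suc d         ∎
  where
    open ≤-Reasoning
    bound : suc m * suc d ≤ n + d
    bound = begin
      suc d + m * suc d     ≡⟨ +-comm (suc d) _ ⟩
      m * suc d + suc d     ≡⟨ +-suc _ d ⟩
      suc (m * suc d) + d   ≤⟨ +-monoˡ-≤ d m*p<n ⟩
      n + d                 ∎

≤*⇒ceilDiv≤ : ∀ {m n} d → n ≤ m * suc d → ceilDiv n (suc d) ≤ m
≤*⇒ceilDiv≤ {m} {n} d n≤m*p = s≤s⁻¹ (m<n*o⇒m/o<n {n + d} {suc m} {suc d} (s≤s bound))
  where
    open ≤-Reasoning
    bound : n + d ≤ d + m * suc d
    bound = begin
      n + d           ≤⟨ +-monoˡ-≤ d n≤m*p ⟩
      m * suc d + d   ≡⟨ +-comm _ d ⟩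
      d + m * suc d   ∎

sucC2 : ∀ n → suc n C 2 ≡ n + n C 2
sucC2 n = ≡.trans (≡.sym (nCk+nC[k+1]≡[n+1]C[k+1] n 1)) (≡.cong (_+ n C 2) (nC1≡n n))

2*nC2≡n*[n∸1] : ∀ n → 2 * (n C 2) ≡ n * (n ∸ 1)
2*nC2≡n*[n∸1] zero          = ≡.refl
2*nC2≡n*[n∸1] (suc zero)    = ≡.refl
2*nC2≡n*[n∸1] (suc (suc n)) = begin
  2 * (suc (suc n) C 2)         ≡⟨ ≡.cong (2 *_) (sucC2 (suc n)) ⟩
  2 * (suc n + suc n C 2)       ≡⟨ *-distribˡ-+ 2 (suc n) _ ⟩
  2 * suc n + 2 * (suc n C 2)   ≡⟨ ≡.cong (2 * suc n +_) (2*nC2≡n*[n∸1] (suc n)) ⟩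
  2 * suc n + suc n * n         ≡⟨ expand n ⟩
  suc (suc n) * suc n           ∎
  where
    open ≡.≡-Reasoning
    expand : ∀ n → 2 * suc n + suc n * n ≡ suc (suc n) * suc n
    expand = solve-∀

oddPrime∣C2 : ∀ {p} → Prime p → p ≢ 2 → p ∣ p C 2
oddPrime∣C2 {p} p-prime p≢2 = coprime-divisor (prime⇒coprime p-prime 2<p) (divides (p ∸ 1) 2*pC2≡[p∸1]*p)
  where
    2<p : 2 < p
    2<p = ≤∧≢⇒< (nonTrivial⇒n>1 p {{prime⇒nonTrivial p-prime}}) (λ 2≡p → p≢2 (≡.sym 2≡p))
    2*pC2≡[p∸1]*p : 2 * (p C 2) ≡ (p ∸ 1) * p
    2*pC2≡[p∸1]*p = ≡.trans (2*nC2≡n*[n∸1] p) (*-comm p (p ∸ 1))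

module _ {c ℓ : Level} (G : Group c ℓ) where

  open Group G renaming (Carrier to A)
  open GroupDefs G
  open import Algebra.Properties.Group G
    using (ε⁻¹≈ε; ⁻¹-anti-homo-∙; inverseˡ-unique; \\-leftDividesˡ; \\-leftDividesʳ)
  open import Algebra.Properties.Semigroup semigroup using (uv≈wx⇒yu∙vz≈yw∙xz)
  open import Algebra.Solver.Monoid monoid using (solve; _⊜_; _⊕_)
  import Algebra.Properties.Monoid.Mult monoid as Mult
  open import Relation.Binary.Reasoning.Setoid setoid

  private variable
    x y g : A
    m n : ℕ
    S H K P X Y : Subset

  -- Powers, conjugation and commutators

  ^≡× : ∀ x n → x ^' n ≡ n Mult.× x
  ^≡× x zero    = ≡.refl
  ^≡× x (suc n) = ≡.cong (x ∙_) (^≡× x n)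

  ^-cong : ∀ n → x ≈ y → x ^' n ≈ y ^' n
  ^-cong {x} {y} n x≈y rewrite ^≡× x n | ^≡× y n = Mult.×-congʳ n x≈y

  ^-+ : ∀ x m n → x ^' (m + n) ≈ x ^' m ∙ x ^' n
  ^-+ x m n rewrite ^≡× x (m + n) | ^≡× x m | ^≡× x n = Mult.×-homo-+ x m n

  ^-* : ∀ x m n → x ^' (m * n) ≈ (x ^' n) ^' m
  ^-* x m n rewrite ^≡× x (m * n) | ^≡× x n | ^≡× (n Mult.× x) m = sym (Mult.×-assocˡ x m n)

  ^-sucʳ : ∀ x n → x ^' suc n ≈ x ^' n ∙ x
  ^-sucʳ x zero    = trans (identityʳ x) (sym (identityˡ x))
  ^-sucʳ x (suc n) = trans (∙-congˡ (^-sucʳ x n)) (sym (assoc _ _ _))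

  ε^ : ∀ n → ε ^' n ≈ ε
  ε^ zero    = refl
  ε^ (suc n) = trans (identityˡ _) (ε^ n)

  ⁻¹-^ : ∀ x n → (x ⁻¹) ^' n ≈ (x ^' n) ⁻¹
  ⁻¹-^ x zero    = sym ε⁻¹≈ε
  ⁻¹-^ x (suc n) = begin
    x ⁻¹ ∙ (x ⁻¹) ^' n   ≈⟨ ∙-congˡ (⁻¹-^ x n) ⟩
    x ⁻¹ ∙ (x ^' n) ⁻¹   ≈⟨ ⁻¹-anti-homo-∙ _ _ ⟨
    (x ^' n ∙ x) ⁻¹      ≈⟨ ⁻¹-cong (^-sucʳ x n) ⟨
    (x ^' suc n) ⁻¹      ∎

  conj : A → A → A
  conj g x = g ⁻¹ ∙ x ∙ g

  conj-ε : ∀ g → conj g ε ≈ ε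
  conj-ε g = trans (∙-congʳ (identityʳ _)) (inverseˡ g)

  conj-∙ : ∀ g x y → conj g (x ∙ y) ≈ conj g x ∙ conj g y
  conj-∙ g x y = sym (begin
    conj g x ∙ conj g y                     ≈⟨ reassoc₁ g (g ⁻¹) x y ⟩
    (g ⁻¹ ∙ x) ∙ ((g ∙ (g ⁻¹ ∙ y)) ∙ g)     ≈⟨ ∙-congˡ (∙-congʳ (\\-leftDividesˡ g y)) ⟩
    (g ⁻¹ ∙ x) ∙ (y ∙ g)                    ≈⟨ reassoc₂ g (g ⁻¹) x y ⟩
    conj g (x ∙ y)                          ∎)
    where
      reassoc₁ : ∀ g g⁻ x y → ((g⁻ ∙ x) ∙ g) ∙ ((g⁻ ∙ y) ∙ g) ≈ (g⁻ ∙ x) ∙ ((g ∙ (g⁻ ∙ y)) ∙ g)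
      reassoc₁ = solve 4 (λ g g⁻ x y → ((g⁻ ⊕ x) ⊕ g) ⊕ ((g⁻ ⊕ y) ⊕ g)
                                     ⊜ (g⁻ ⊕ x) ⊕ ((g ⊕ (g⁻ ⊕ y)) ⊕ g)) refl
      reassoc₂ : ∀ g g⁻ x y → (g⁻ ∙ x) ∙ (y ∙ g) ≈ (g⁻ ∙ (x ∙ y)) ∙ g
      reassoc₂ = solve 4 (λ g g⁻ x y → (g⁻ ⊕ x) ⊕ (y ⊕ g) ⊜ (g⁻ ⊕ (x ⊕ y)) ⊕ g) refl

  conj-⁻¹ : ∀ g x → conj g (x ⁻¹) ≈ conj g x ⁻¹
  conj-⁻¹ g x = inverseˡ-unique _ _ (begin
    conj g (x ⁻¹) ∙ conj g x   ≈⟨ conj-∙ g (x ⁻¹) x ⟨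
    conj g (x ⁻¹ ∙ x)          ≈⟨ ∙-congʳ (∙-congˡ (inverseˡ x)) ⟩
    conj g ε                   ≈⟨ conj-ε g ⟩
    ε                          ∎)

  conj-^ : ∀ g x n → conj g (x ^' n) ≈ conj g x ^' n
  conj-^ g x zero    = conj-ε g
  conj-^ g x (suc n) = trans (conj-∙ g x _) (∙-congˡ (conj-^ g x n))

  ∙-conj : ∀ g x → g ∙ conj g x ≈ x ∙ g
  ∙-conj g x = trans (∙-congˡ (assoc _ _ _)) (\\-leftDividesˡ g (x ∙ g))

  ⁅⁆≈⁻¹∙conj : ∀ x g → ⁅ x , g ⁆ ≈ x ⁻¹ ∙ conj g x
  ⁅⁆≈⁻¹∙conj x g = trans (∙-congʳ (assoc _ _ _)) (assoc _ _ _)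

  conj≈∙⁅⁆ : ∀ x g → conj g x ≈ x ∙ ⁅ x , g ⁆
  conj≈∙⁅⁆ x g = sym (trans (∙-congˡ (⁅⁆≈⁻¹∙conj x g)) (\\-leftDividesˡ x _))

  ∙≈∙∙⁅⁆ : ∀ x y → x ∙ y ≈ (y ∙ x) ∙ ⁅ x , y ⁆
  ∙≈∙∙⁅⁆ x y = sym (begin
    (y ∙ x) ∙ ⁅ x , y ⁆   ≈⟨ assoc y x _ ⟩
    y ∙ (x ∙ ⁅ x , y ⁆)   ≈⟨ ∙-congˡ (conj≈∙⁅⁆ x y) ⟨
    y ∙ conj y x          ≈⟨ ∙-conj y x ⟩
    x ∙ y                 ∎)

  ⁅⁆-congˡ : x ≈ y → ⁅ x , g ⁆ ≈ ⁅ y , g ⁆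
  ⁅⁆-congˡ x≈y = ∙-congʳ (∙-cong (∙-congʳ (⁻¹-cong x≈y)) x≈y)

  Central : Subset
  Central x = ∀ g → conj g x ≈ x

  central⇒comm : Central x → ∀ g → x ∙ g ≈ g ∙ x
  central⇒comm {x} x-central g = trans (sym (∙-conj g x)) (∙-congˡ (x-central g))

  central⇒⁅⁆≈ε : Central x → ∀ g → ⁅ x , g ⁆ ≈ ε
  central⇒⁅⁆≈ε {x} x-central g = begin
    ⁅ x , g ⁆           ≈⟨ ⁅⁆≈⁻¹∙conj x g ⟩
    x ⁻¹ ∙ conj g x     ≈⟨ ∙-congˡ (x-central g) ⟩
    x ⁻¹ ∙ x            ≈⟨ inverseˡ x ⟩
    ε                   ∎

  ⁅⁆≈ε⇒conj≈ : ⁅ x , g ⁆ ≈ ε → conj g x ≈ x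
  ⁅⁆≈ε⇒conj≈ {x} {g} ⁅x,g⁆≈ε = begin
    conj g x            ≈⟨ conj≈∙⁅⁆ x g ⟩
    x ∙ ⁅ x , g ⁆       ≈⟨ ∙-congˡ ⁅x,g⁆≈ε ⟩
    x ∙ ε               ≈⟨ identityʳ x ⟩
    x                   ∎

  -- Subgroups

  record IsSubgroup (P : Subset) : Set (c ⊔ ℓ) where
    field
      ε-closed  : P ε
      ∙-closed  : P x → P y → P (x ∙ y)
      ⁻¹-closed : P x → P (x ⁻¹)
      ≈-closed  : x ≈ y → P x → P y

    ^-closed : ∀ n → P x → P (x ^' n)
    ^-closed zero    _  = ε-closed
    ^-closed (suc n) Px = ∙-closed Px (^-closed n Px)

  open IsSubgroup

  whole-isSubgroup : IsSubgroup whole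
  whole-isSubgroup = record
    { ε-closed = tt ; ∙-closed = λ _ _ → tt ; ⁻¹-closed = λ _ → tt ; ≈-closed = λ _ _ → tt }

  ⟨⟩-isSubgroup : IsSubgroup ⟨ S ⟩
  ⟨⟩-isSubgroup = record { ε-closed = one ; ∙-closed = mul ; ⁻¹-closed = inv ; ≈-closed = resp }

  ⟨⟩-least : IsSubgroup P → S ⊆ P → ⟨ S ⟩ ⊆ P
  ⟨⟩-least P-sub S⊆P (gen s)    = S⊆P s
  ⟨⟩-least P-sub S⊆P one        = ε-closed P-sub
  ⟨⟩-least P-sub S⊆P (mul u v)  = ∙-closed P-sub (⟨⟩-least P-sub S⊆P u) (⟨⟩-least P-sub S⊆P v)
  ⟨⟩-least P-sub S⊆P (inv u)    = ⁻¹-closed P-sub (⟨⟩-least P-sub S⊆P u)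
  ⟨⟩-least P-sub S⊆P (resp e u) = ≈-closed P-sub e (⟨⟩-least P-sub S⊆P u)

  ⁅⁆∈γ₂ : ∀ x y → γ₂ ⁅ x , y ⁆
  ⁅⁆∈γ₂ x y = gen (x , y , tt , tt , refl)

  comm⊆γ₂ : comm H K ⊆ γ₂
  comm⊆γ₂ = ⟨⟩-least ⟨⟩-isSubgroup λ (h , k , _ , _ , e) → resp (sym e) (⁅⁆∈γ₂ h k)

  centre-isSubgroup : IsSubgroup Central
  centre-isSubgroup = record
    { ε-closed  = conj-ε
    ; ∙-closed  = λ x-central y-central g → trans (conj-∙ g _ _) (∙-cong (x-central g) (y-central g))
    ; ⁻¹-closed = λ x-central g → trans (conj-⁻¹ g _) (⁻¹-cong (x-central g))
    ; ≈-closed  = λ x≈y x-central g → trans (∙-congʳ (∙-congˡ (sym x≈y))) (trans (x-central g) x≈y)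
    }

  central-∙-^ : Central x → ∀ y n → (x ∙ y) ^' n ≈ x ^' n ∙ y ^' n
  central-∙-^ x-central y zero    = sym (identityˡ ε)
  central-∙-^ {x} x-central y (suc n) = begin
    (x ∙ y) ∙ (x ∙ y) ^' n           ≈⟨ ∙-congˡ (central-∙-^ x-central y n) ⟩
    (x ∙ y) ∙ (x ^' n ∙ y ^' n)      ≈⟨ uv≈wx⇒yu∙vz≈yw∙xz (sym (central⇒comm xⁿ-central y)) x (y ^' n) ⟩
    (x ∙ x ^' n) ∙ (y ∙ y ^' n)      ∎
    where
      xⁿ-central : Central (x ^' n)
      xⁿ-central = ^-closed centre-isSubgroup n x-central

  prod-isSubgroup : IsSubgroup H → IsSubgroup K → H ⊆ Central → IsSubgroup (prod H K)
  prod-isSubgroup H-sub K-sub H⊆Z = record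
    { ε-closed  = ε , ε , ε-closed H-sub , ε-closed K-sub , sym (identityˡ ε)
    ; ∙-closed  = λ (h , k , Hh , Kk , e) (h′ , k′ , Hh′ , Kk′ , e′) →
        h ∙ h′ , k ∙ k′ , ∙-closed H-sub Hh Hh′ , ∙-closed K-sub Kk Kk′ ,
        trans (∙-cong e e′) (uv≈wx⇒yu∙vz≈yw∙xz (sym (central⇒comm (H⊆Z Hh′) k)) h k′)
    ; ⁻¹-closed = λ (h , k , Hh , Kk , e) →
        h ⁻¹ , k ⁻¹ , ⁻¹-closed H-sub Hh , ⁻¹-closed K-sub Kk ,
        trans (⁻¹-cong e) (trans (⁻¹-anti-homo-∙ h k) (sym (central⇒comm (H⊆Z (⁻¹-closed H-sub Hh)) (k ⁻¹))))
    ; ≈-closed  = λ x≈y (h , k , Hh , Kk , e) → h , k , Hh , Kk , trans (sym x≈y) e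
    }

  prod-least : IsSubgroup P → H ⊆ P → K ⊆ P → prod H K ⊆ P
  prod-least P-sub H⊆P K⊆P (h , k , Hh , Kk , e) = ≈-closed P-sub (sym e) (∙-closed P-sub (H⊆P Hh) (K⊆P Kk))

  ⊆-prodˡ : IsSubgroup K → H ⊆ prod H K
  ⊆-prodˡ K-sub {h} Hh = h , ε , Hh , ε-closed K-sub , sym (identityʳ h)

  ⊆-prodʳ : IsSubgroup H → K ⊆ prod H K
  ⊆-prodʳ H-sub {k} Kk = ε , k , ε-closed H-sub , Kk , sym (identityˡ k)

  pow-⊆ : IsSubgroup H → ∀ n → pow H n ⊆ H
  pow-⊆ H-sub n = ⟨⟩-least H-sub (λ (h , Hh , e) → ≈-closed H-sub (sym e) (^-closed H-sub n Hh))

  pow-∣ : IsSubgroup H → m ∣ n → pow H n ⊆ pow H m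
  pow-∣ {m = m} {n = n} H-sub (divides q n≡q*m) = ⟨⟩-least ⟨⟩-isSubgroup λ (h , Hh , e) →
    gen (h ^' q , ^-closed H-sub q Hh , trans e (trans (reflexive (≡.cong (h ^'_) n≡m*q)) (^-* h m q)))
    where
      n≡m*q : n ≡ m * q
      n≡m*q = ≡.trans n≡q*m (*-comm q m)

  pow-pow : ∀ n k → pow H k ⊆ Y → pow H (n * k) ⊆ pow Y n
  pow-pow n k Hᵏ⊆Y = ⟨⟩-least ⟨⟩-isSubgroup λ (h , Hh , e) →
    gen (h ^' k , Hᵏ⊆Y (gen (h , Hh , refl)) , trans e (^-* h n k))

  ^-⟨⟩ : ∀ n → ⟨ S ⟩ ⊆ Central → IsSubgroup P →
         (∀ {x} → S x → P (x ^' n)) → ∀ {x} → ⟨ S ⟩ x → P (x ^' n)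
  ^-⟨⟩ n Z P-sub f (gen s)    = f s
  ^-⟨⟩ n Z P-sub f one        = ≈-closed P-sub (sym (ε^ n)) (ε-closed P-sub)
  ^-⟨⟩ n Z P-sub f (mul u v)  =
    ≈-closed P-sub (sym (central-∙-^ (Z u) _ n)) (∙-closed P-sub (^-⟨⟩ n Z P-sub f u) (^-⟨⟩ n Z P-sub f v))
  ^-⟨⟩ n Z P-sub f (inv u)    = ≈-closed P-sub (sym (⁻¹-^ _ n)) (⁻¹-closed P-sub (^-⟨⟩ n Z P-sub f u))
  ^-⟨⟩ n Z P-sub f (resp e u) = ≈-closed P-sub (^-cong n e) (^-⟨⟩ n Z P-sub f u)

  -- Groups of class at most two

  module ClassAtMostTwo (class≤2 : ∀ x → comm γ₂ whole x → x ≈ ε) where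

    ⁅⁆-central : ∀ x y → Central ⁅ x , y ⁆
    ⁅⁆-central x y g = ⁅⁆≈ε⇒conj≈ (class≤2 _ (gen (⁅ x , y ⁆ , g , ⁅⁆∈γ₂ x y , tt , refl)))

    γ₂-central : γ₂ ⊆ Central
    γ₂-central = ⟨⟩-least centre-isSubgroup λ (x , y , _ , _ , e) →
      ≈-closed centre-isSubgroup (sym e) (⁅⁆-central x y)

    ⁅∙,⁆ : ∀ x y g → ⁅ x ∙ y , g ⁆ ≈ ⁅ x , g ⁆ ∙ ⁅ y , g ⁆
    ⁅∙,⁆ x y g = begin
      ⁅ x ∙ y , g ⁆                                      ≈⟨ ⁅⁆≈⁻¹∙conj (x ∙ y) g ⟩
      (x ∙ y) ⁻¹ ∙ conj g (x ∙ y)                        ≈⟨ ∙-congˡ (conj-∙ g x y) ⟩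
      (x ∙ y) ⁻¹ ∙ (conj g x ∙ conj g y)                 ≈⟨ ∙-congˡ (∙-cong (conj≈∙⁅⁆ x g) (conj≈∙⁅⁆ y g)) ⟩
      (x ∙ y) ⁻¹ ∙ ((x ∙ ⁅ x , g ⁆) ∙ (y ∙ ⁅ y , g ⁆))   ≈⟨ ∙-congˡ (uv≈wx⇒yu∙vz≈yw∙xz ⁅x,g⁆∙y≈y∙⁅x,g⁆ x _) ⟩
      (x ∙ y) ⁻¹ ∙ ((x ∙ y) ∙ (⁅ x , g ⁆ ∙ ⁅ y , g ⁆))   ≈⟨ \\-leftDividesʳ (x ∙ y) _ ⟩
      ⁅ x , g ⁆ ∙ ⁅ y , g ⁆                              ∎
      where
        ⁅x,g⁆∙y≈y∙⁅x,g⁆ : ⁅ x , g ⁆ ∙ y ≈ y ∙ ⁅ x , g ⁆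
        ⁅x,g⁆∙y≈y∙⁅x,g⁆ = central⇒comm (⁅⁆-central x g) y

    ⁅⁻¹,⁆ : ∀ x g → ⁅ x ⁻¹ , g ⁆ ≈ ⁅ x , g ⁆ ⁻¹
    ⁅⁻¹,⁆ x g = inverseˡ-unique _ _ (begin
      ⁅ x ⁻¹ , g ⁆ ∙ ⁅ x , g ⁆   ≈⟨ ⁅∙,⁆ (x ⁻¹) x g ⟨
      ⁅ x ⁻¹ ∙ x , g ⁆           ≈⟨ ⁅⁆-congˡ (inverseˡ x) ⟩
      ⁅ ε , g ⁆                  ≈⟨ central⇒⁅⁆≈ε conj-ε g ⟩
      ε                          ∎)

    ⁅^,⁆ : ∀ x g n → ⁅ x ^' n , g ⁆ ≈ ⁅ x , g ⁆ ^' n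
    ⁅^,⁆ x g zero    = central⇒⁅⁆≈ε conj-ε g
    ⁅^,⁆ x g (suc n) = trans (⁅∙,⁆ x _ g) (∙-congˡ (⁅^,⁆ x g n))

    ^∙≈∙^∙⁅⁆^ : ∀ x y n → y ^' n ∙ x ≈ (x ∙ y ^' n) ∙ ⁅ y , x ⁆ ^' n
    ^∙≈∙^∙⁅⁆^ x y n = trans (∙≈∙∙⁅⁆ (y ^' n) x) (∙-congˡ (⁅^,⁆ y x n))

    ∙-^ : ∀ x y n → (x ∙ y) ^' n ≈ (x ^' n ∙ y ^' n) ∙ ⁅ y , x ⁆ ^' (n C 2)
    ∙-^ x y zero    = sym (trans (identityʳ _) (identityˡ ε))
    ∙-^ x y (suc n) = begin
      (x ∙ y) ^' suc n                              ≈⟨ ^-sucʳ (x ∙ y) n ⟩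
      (x ∙ y) ^' n ∙ (x ∙ y)                        ≈⟨ ∙-congʳ (∙-^ x y n) ⟩
      ((xⁿ ∙ yⁿ) ∙ d) ∙ (x ∙ y)                     ≈⟨ moveʳ d-central ⟩
      ((xⁿ ∙ yⁿ) ∙ (x ∙ y)) ∙ d                     ≈⟨ ∙-congʳ reassoc₁ ⟩
      (xⁿ ∙ ((yⁿ ∙ x) ∙ y)) ∙ d                     ≈⟨ ∙-congʳ (∙-congˡ (∙-congʳ (^∙≈∙^∙⁅⁆^ x y n))) ⟩
      (xⁿ ∙ (((x ∙ yⁿ) ∙ e) ∙ y)) ∙ d               ≈⟨ ∙-congʳ (∙-congˡ (moveʳ e-central)) ⟩
      (xⁿ ∙ (((x ∙ yⁿ) ∙ y) ∙ e)) ∙ d               ≈⟨ reassoc₂ ⟩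
      ((xⁿ ∙ x) ∙ (yⁿ ∙ y)) ∙ (e ∙ d)               ≈⟨ ∙-cong (∙-cong (^-sucʳ x n) (^-sucʳ y n))
                                                              (^-+ ⁅ y , x ⁆ n (n C 2)) ⟨
      (x ^' suc n ∙ y ^' suc n) ∙ ⁅ y , x ⁆ ^' (n + n C 2)
        ≡⟨ ≡.cong (λ m → (x ^' suc n ∙ y ^' suc n) ∙ ⁅ y , x ⁆ ^' m) (sucC2 n) ⟨
      (x ^' suc n ∙ y ^' suc n) ∙ ⁅ y , x ⁆ ^' (suc n C 2)   ∎
      where
        xⁿ yⁿ d e : A
        xⁿ = x ^' n
        yⁿ = y ^' n
        d = ⁅ y , x ⁆ ^' (n C 2)
        e = ⁅ y , x ⁆ ^' n
        d-central : Central d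
        d-central = ^-closed centre-isSubgroup (n C 2) (⁅⁆-central y x)
        e-central : Central e
        e-central = ^-closed centre-isSubgroup n (⁅⁆-central y x)
        reassoc₁ : (xⁿ ∙ yⁿ) ∙ (x ∙ y) ≈ xⁿ ∙ ((yⁿ ∙ x) ∙ y)
        reassoc₁ = solve 4 (λ a b x y → (a ⊕ b) ⊕ (x ⊕ y) ⊜ a ⊕ ((b ⊕ x) ⊕ y)) refl xⁿ yⁿ x y
        reassoc₂ : (xⁿ ∙ (((x ∙ yⁿ) ∙ y) ∙ e)) ∙ d ≈ ((xⁿ ∙ x) ∙ (yⁿ ∙ y)) ∙ (e ∙ d)
        reassoc₂ = solve 6 (λ a b x y e d → (a ⊕ (((x ⊕ b) ⊕ y) ⊕ e)) ⊕ d ⊜ ((a ⊕ x) ⊕ (b ⊕ y)) ⊕ (e ⊕ d))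
                           refl xⁿ yⁿ x y e d
        moveʳ : ∀ {z} → Central z → ∀ {u v} → (u ∙ z) ∙ v ≈ (u ∙ v) ∙ z
        moveʳ z-central {u} {v} = trans (assoc u _ v) (trans (∙-congˡ (central⇒comm z-central v)) (sym (assoc u v _)))

    ∙-^-∣ : ∀ x y n q → n C 2 ≡ q * n → (x ∙ y) ^' n ≈ (x ^' n ∙ y ^' n) ∙ (⁅ y , x ⁆ ^' n) ^' q
    ∙-^-∣ x y n q nC2≡q*n = begin
      (x ∙ y) ^' n                               ≈⟨ ∙-^ x y n ⟩
      (x ^' n ∙ y ^' n) ∙ ⁅ y , x ⁆ ^' (n C 2)   ≡⟨ ≡.cong (λ m → (x ^' n ∙ y ^' n) ∙ ⁅ y , x ⁆ ^' m) nC2≡q*n ⟩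
      (x ^' n ∙ y ^' n) ∙ ⁅ y , x ⁆ ^' (q * n)   ≈⟨ ∙-congˡ (^-* ⁅ y , x ⁆ q n) ⟩
      (x ^' n ∙ y ^' n) ∙ (⁅ y , x ⁆ ^' n) ^' q  ∎

    γ₂^-central : ∀ k → pow γ₂ k ⊆ Central
    γ₂^-central k γ₂ᵏx = γ₂-central (pow-⊆ ⟨⟩-isSubgroup k γ₂ᵏx)

    γ₂^-^ : ∀ n k → pow γ₂ k x → pow γ₂ (n * k) (x ^' n)
    γ₂^-^ n k = ^-⟨⟩ n (γ₂^-central k) ⟨⟩-isSubgroup λ (h , γ₂h , e) →
      gen (h , γ₂h , trans (^-cong n e) (sym (^-* h n k)))

    G^-⁅⁆ : ∀ k → pow whole k y → ∀ g → pow γ₂ k ⁅ y , g ⁆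
    G^-⁅⁆ k (gen (h , _ , e)) g = gen (⁅ h , g ⁆ , ⁅⁆∈γ₂ h g , trans (⁅⁆-congˡ e) (⁅^,⁆ h g k))
    G^-⁅⁆ k one        g = resp (sym (central⇒⁅⁆≈ε conj-ε g)) one
    G^-⁅⁆ k (mul u v)  g = resp (sym (⁅∙,⁆ _ _ g)) (mul (G^-⁅⁆ k u g) (G^-⁅⁆ k v g))
    G^-⁅⁆ k (inv u)    g = resp (sym (⁅⁻¹,⁆ _ g)) (inv (G^-⁅⁆ k u g))
    G^-⁅⁆ k (resp e u) g = resp (⁅⁆-congˡ e) (G^-⁅⁆ k u g)

    -- [a,b]ⁿ = [aⁿ,b] = (aⁿ)⁻¹ (b⁻¹ a b)ⁿ
    γ₂^⊆G^ : ∀ n → pow γ₂ n ⊆ pow whole n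
    γ₂^⊆G^ n = ⟨⟩-least ⟨⟩-isSubgroup λ (h , γ₂h , e) →
      resp (sym e) (^-⟨⟩ n γ₂-central ⟨⟩-isSubgroup ⁅⁆^∈G^ γ₂h)
      where
        ⁅⁆^∈G^ : ∀ {x} → (Σ A λ a → Σ A λ b → whole a × whole b × x ≈ ⁅ a , b ⁆) →
                 pow whole n (x ^' n)
        ⁅⁆^∈G^ (a , b , _ , _ , e) = resp (sym (begin
          _                              ≈⟨ ^-cong n e ⟩
          ⁅ a , b ⁆ ^' n                 ≈⟨ ⁅^,⁆ a b n ⟨
          ⁅ a ^' n , b ⁆                 ≈⟨ ⁅⁆≈⁻¹∙conj _ b ⟩
          (a ^' n) ⁻¹ ∙ conj b (a ^' n)  ≈⟨ ∙-congˡ (conj-^ b a n) ⟩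
          (a ^' n) ⁻¹ ∙ conj b a ^' n    ∎))
          (mul (inv (gen (a , tt , refl))) (gen (conj b a , tt , refl)))

    G^-^ : ∀ n → n ∣ n C 2 → ∀ k → pow whole k y → pow whole (n * k) (y ^' n)
    G^-^ n _ k (gen (h , _ , e)) = gen (h , tt , trans (^-cong n e) (sym (^-* h n k)))
    G^-^ n _ k one = resp (sym (ε^ n)) one
    G^-^ n n∣nC2@(divides q nC2≡q*n) k (mul {x} {y} u v) = resp (sym (∙-^-∣ x y n q nC2≡q*n))
      (mul (mul (G^-^ n n∣nC2 k u) (G^-^ n n∣nC2 k v))
           (^-closed ⟨⟩-isSubgroup q (γ₂^⊆G^ (n * k) (γ₂^-^ n k (G^-⁅⁆ k v x)))))
    G^-^ n n∣nC2 k (inv u)    = resp (sym (⁻¹-^ _ n)) (inv (G^-^ n n∣nC2 k u))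
    G^-^ n n∣nC2 k (resp e u) = resp (^-cong n e) (G^-^ n n∣nC2 k u)

    infix 5 γ₂^_·G^_
    γ₂^_·G^_ : ℕ → ℕ → Subset
    γ₂^ k ·G^ l = prod (pow γ₂ k) (pow whole l)

    γ₂^·G^-isSubgroup : ∀ k l → IsSubgroup (γ₂^ k ·G^ l)
    γ₂^·G^-isSubgroup k l = prod-isSubgroup ⟨⟩-isSubgroup ⟨⟩-isSubgroup (γ₂^-central k)

    whole⊆γ₂^1·G^1 : whole ⊆ γ₂^ 1 ·G^ 1
    whole⊆γ₂^1·G^1 {x} _ = ⊆-prodʳ ⟨⟩-isSubgroup (gen (x , tt , sym (identityʳ x)))

    γ₂^·G^-⁅⁆ : ∀ k l → (γ₂^ k ·G^ l) x → ∀ g → pow γ₂ l ⁅ x , g ⁆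
    γ₂^·G^-⁅⁆ {x} k l (c , y , γ₂ᵏc , Gˡy , e) g = resp (sym ⁅x,g⁆≈⁅y,g⁆) (G^-⁅⁆ l Gˡy g)
      where
        ⁅x,g⁆≈⁅y,g⁆ : ⁅ x , g ⁆ ≈ ⁅ y , g ⁆
        ⁅x,g⁆≈⁅y,g⁆ = begin
          ⁅ x , g ⁆               ≈⟨ ⁅⁆-congˡ e ⟩
          ⁅ c ∙ y , g ⁆           ≈⟨ ⁅∙,⁆ c y g ⟩
          ⁅ c , g ⁆ ∙ ⁅ y , g ⁆   ≈⟨ ∙-congʳ (central⇒⁅⁆≈ε (γ₂^-central k γ₂ᵏc) g) ⟩
          ε ∙ ⁅ y , g ⁆           ≈⟨ identityˡ _ ⟩
          ⁅ y , g ⁆               ∎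

    γ₂^·G^-^ : ∀ n → n ∣ n C 2 → ∀ k l → (γ₂^ k ·G^ l) x → (γ₂^ (n * k) ·G^ (n * l)) (x ^' n)
    γ₂^·G^-^ n n∣nC2 k l (c , y , γ₂ᵏc , Gˡy , e) =
      c ^' n , y ^' n , γ₂^-^ n k γ₂ᵏc , G^-^ n n∣nC2 l Gˡy ,
      trans (^-cong n e) (central-∙-^ (γ₂^-central k γ₂ᵏc) y n)

    γ₂^·G^-∣ : ∀ {k k′ l l′} → k ∣ k′ → l ∣ l′ → γ₂^ k′ ·G^ l′ ⊆ γ₂^ k ·G^ l
    γ₂^·G^-∣ k∣k′ l∣l′ (c , y , γ₂ᵏc , Gˡy , e) =
      c , y , pow-∣ ⟨⟩-isSubgroup k∣k′ γ₂ᵏc , pow-∣ whole-isSubgroup l∣l′ Gˡy , e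

    -- The Brauer–Jennings–Zassenhaus series

    module BrauerJenningsZassenhaus (q : ℕ) (p∣pC2 : 2 + q ∣ (2 + q) C 2) where

      p : ℕ
      p = 2 + q

      ⁅_,G⁆·_^p : Subset → Subset → Subset
      ⁅ X ,G⁆· Y ^p = prod (comm X whole) (pow Y p)

      step-isSubgroup : ∀ X Y → IsSubgroup (⁅ X ,G⁆· Y ^p)
      step-isSubgroup X Y = prod-isSubgroup ⟨⟩-isSubgroup ⟨⟩-isSubgroup (λ u → γ₂-central (comm⊆γ₂ u))

      step⊆γ₂^·G^ : ∀ {k k′ l l′} → X ⊆ γ₂^ 1 ·G^ k → Y ⊆ γ₂^ k′ ·G^ l′ → k ∣ p * k′ → l ∣ p * l′ →
                    ⁅ X ,G⁆· Y ^p ⊆ γ₂^ k ·G^ l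
      step⊆γ₂^·G^ {k = k} {k′} {l} {l′} X⊆ Y⊆ k∣pk′ l∣pl′ = prod-least γ₂ᵏGˡ-sub
        (⟨⟩-least γ₂ᵏGˡ-sub λ (h , g , Xh , _ , e) →
          ⊆-prodˡ ⟨⟩-isSubgroup (resp (sym e) (γ₂^·G^-⁅⁆ 1 k (X⊆ Xh) g)))
        (⟨⟩-least γ₂ᵏGˡ-sub λ (w , Yw , e) →
          ≈-closed γ₂ᵏGˡ-sub (sym e) (γ₂^·G^-∣ k∣pk′ l∣pl′ (γ₂^·G^-^ p p∣pC2 k′ l′ (Y⊆ Yw))))
        where
          γ₂ᵏGˡ-sub : IsSubgroup (γ₂^ k ·G^ l)
          γ₂ᵏGˡ-sub = γ₂^·G^-isSubgroup k l

      γ₂⊆step : whole ⊆ X → γ₂ ⊆ ⁅ X ,G⁆· Y ^p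
      γ₂⊆step whole⊆X γ₂x = ⊆-prodˡ ⟨⟩-isSubgroup
        (⟨⟩-least ⟨⟩-isSubgroup (λ (a , b , _ , _ , e) → gen (a , b , whole⊆X tt , tt , e)) γ₂x)

      pow⊆step : ∀ k → pow H k ⊆ Y → pow H (p * k) ⊆ ⁅ X ,G⁆· Y ^p
      pow⊆step k Hᵏ⊆Y u = ⊆-prodʳ ⟨⟩-isSubgroup (pow-pow p k Hᵏ⊆Y u)

      -- a ≤index[ k ] n  iff  a ≤ min { a′ : n ≤ k · pᵃ′ }
      infix 4 _≤index[_]_
      _≤index[_]_ : ℕ → ℕ → ℕ → Set
      zero  ≤index[ k ] n = ⊤
      suc a ≤index[ k ] n = k * p ^ a < n

      1≤pᵃ : ∀ a → 1 ≤ p ^ a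
      1≤pᵃ = m^n>0 p

      2pᵃ≤pᵃ⁺¹ : ∀ a → 2 * p ^ a ≤ p ^ suc a
      2pᵃ≤pᵃ⁺¹ a = *-monoˡ-≤ (p ^ a) (m≤m+n 2 q)

      *pᵃ⁺¹≡*pᵃ*p : ∀ k a → k * p ^ suc a ≡ k * p ^ a * p
      *pᵃ⁺¹≡*pᵃ*p k a = ≡.trans (≡.cong (k *_) (*-comm p (p ^ a))) (≡.sym (*-assoc k (p ^ a) p))

      pᵃ∣p*pᵃ⁻¹ : ∀ a → p ^ a ∣ p * p ^ (a ∸ 1)
      pᵃ∣p*pᵃ⁻¹ zero    = 1∣ _
      pᵃ∣p*pᵃ⁻¹ (suc a) = ∣-refl

      ≤*p⇒ceilDiv≤ : ∀ {m n} → n ≤ m * p → ceilDiv n p ≤ m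
      ≤*p⇒ceilDiv≤ = ≤*⇒ceilDiv≤ (suc q)

      ceilDiv≤pred : ∀ n → ceilDiv (2 + n) p ≤ suc n
      ceilDiv≤pred n = ≤*p⇒ceilDiv≤ (+-mono-≤ (m≤m+n 2 q) (m≤m*n n p))

      ≤index-ceilDiv : ∀ {k n} a → a ≤index[ k ] n → a ∸ 1 ≤index[ k ] ceilDiv n p
      ≤index-ceilDiv zero                _       = tt
      ≤index-ceilDiv (suc zero)          _       = tt
      ≤index-ceilDiv {k} {n} (suc (suc a)) kpᵃ⁺¹<n =
        *<⇒<ceilDiv (suc q) (≡.subst (_< n) (*pᵃ⁺¹≡*pᵃ*p k a) kpᵃ⁺¹<n)

      ≤index-halve : ∀ {n} a → a ≤index[ 2 ] suc n → a ≤index[ 1 ] n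
      ≤index-halve zero    _       = tt
      ≤index-halve (suc a) 2pᵃ<1+n = ≤-trans (+-monoˡ-≤ (1 * p ^ a) (1≤pᵃ a)) (s≤s⁻¹ 2pᵃ<1+n)

      ≤1⇒¬suc≤index : ∀ {k n} a → n ≤ 1 → ¬ (suc a ≤index[ suc k ] n)
      ≤1⇒¬suc≤index {k} a n≤1 kpᵃ<n =
        <⇒≱ (<-≤-trans kpᵃ<n n≤1) (*-mono-≤ {1} {suc k} (s≤s z≤n) (1≤pᵃ a))

      whole⊆γ₂^·G^ : ∀ {n} a b → n ≤ 1 → a ≤index[ 2 ] n → b ≤index[ 1 ] n →
                     whole ⊆ γ₂^ p ^ a ·G^ p ^ b
      whole⊆γ₂^·G^ zero    zero    _   _  _  = whole⊆γ₂^1·G^1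
      whole⊆γ₂^·G^ (suc a) _       n≤1 ia _  = ⊥-elim (≤1⇒¬suc≤index {k = 1} a n≤1 ia)
      whole⊆γ₂^·G^ zero    (suc b) n≤1 _  ib = ⊥-elim (≤1⇒¬suc≤index {k = 0} b n≤1 ib)

      MAux⊆γ₂^·G^ : ∀ f n → n ≤ f → ∀ a b → a ≤index[ 2 ] n → b ≤index[ 1 ] n →
                 MAux p f n ⊆ γ₂^ p ^ a ·G^ p ^ b
      MAux⊆γ₂^·G^ zero    zero          _         a b ia ib _ = whole⊆γ₂^·G^ a b z≤n ia ib tt
      MAux⊆γ₂^·G^ (suc f) zero          _         a b ia ib _ = whole⊆γ₂^·G^ a b z≤n ia ib tt
      MAux⊆γ₂^·G^ (suc f) (suc zero)    _         a b ia ib _ = whole⊆γ₂^·G^ a b ≤-refl ia ib tt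
      MAux⊆γ₂^·G^ (suc f) (suc (suc n)) (s≤s n<f) a b ia ib =
        step⊆γ₂^·G^ {k′ = p ^ (a ∸ 1)} {l′ = p ^ (b ∸ 1)}
                    (MAux⊆γ₂^·G^ f (suc n) n<f 0 a tt (≤index-halve a ia))
                    (MAux⊆γ₂^·G^ f _ (≤-trans (ceilDiv≤pred n) n<f) (a ∸ 1) (b ∸ 1)
                              (≤index-ceilDiv a ia) (≤index-ceilDiv b ib))
                    (pᵃ∣p*pᵃ⁻¹ a) (pᵃ∣p*pᵃ⁻¹ b)

      γ₂^·G^⊆MAux : ∀ f n → n ≤ f → ∀ a b → n ≤ 2 * p ^ a → n ≤ p ^ b →
                 γ₂^ p ^ a ·G^ p ^ b ⊆ MAux p f n
      γ₂^·G^⊆MAux zero    zero          _         _ _ _ _ _ = tt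
      γ₂^·G^⊆MAux (suc f) zero          _         _ _ _ _ _ = tt
      γ₂^·G^⊆MAux (suc f) (suc zero)    _         _ _ _ _ _ = tt
      γ₂^·G^⊆MAux (suc f) (suc (suc n)) (s≤s n<f) a b n≤2pᵃ n≤pᵇ =
        prod-least (step-isSubgroup Mₙ₊₁ Mⱼ) (γ₂^⊆step a n≤2pᵃ) (G^⊆step b n≤pᵇ)
        where
          j : ℕ
          j = ceilDiv (2 + n) p
          Mₙ₊₁ Mⱼ : Subset
          Mₙ₊₁ = MAux p f (suc n)
          Mⱼ   = MAux p f j
          Mⱼ⊇ : ∀ a b → j ≤ 2 * p ^ a → j ≤ p ^ b → γ₂^ p ^ a ·G^ p ^ b ⊆ Mⱼ
          Mⱼ⊇ = γ₂^·G^⊆MAux f j (≤-trans (ceilDiv≤pred n) n<f)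
          γ₂^⊆step : ∀ a → 2 + n ≤ 2 * p ^ a → pow γ₂ (p ^ a) ⊆ ⁅ Mₙ₊₁ ,G⁆· Mⱼ ^p
          γ₂^⊆step zero    2+n≤2 γ₂x = γ₂⊆step whole⊆Mₙ₊₁ (pow-⊆ ⟨⟩-isSubgroup 1 γ₂x)
            where
              whole⊆Mₙ₊₁ : whole ⊆ Mₙ₊₁
              whole⊆Mₙ₊₁ _ = γ₂^·G^⊆MAux f (suc n) n<f 0 0 (m≤n⇒m≤1+n (s≤s⁻¹ 2+n≤2)) (s≤s⁻¹ 2+n≤2)
                                          (whole⊆γ₂^1·G^1 tt)
          γ₂^⊆step (suc a) 2+n≤2pᵃ⁺¹ =
            pow⊆step (p ^ a) (λ u → Mⱼ⊇ a (suc a) j≤2pᵃ (≤-trans j≤2pᵃ (2pᵃ≤pᵃ⁺¹ a)) (⊆-prodˡ ⟨⟩-isSubgroup u))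
            where
              j≤2pᵃ : j ≤ 2 * p ^ a
              j≤2pᵃ = ≤*p⇒ceilDiv≤ (≡.subst (2 + n ≤_) (*pᵃ⁺¹≡*pᵃ*p 2 a) 2+n≤2pᵃ⁺¹)
          G^⊆step : ∀ b → 2 + n ≤ p ^ b → pow whole (p ^ b) ⊆ ⁅ Mₙ₊₁ ,G⁆· Mⱼ ^p
          G^⊆step zero    (s≤s ())
          G^⊆step (suc b) 2+n≤pᵇ⁺¹ =
            pow⊆step (p ^ b) (λ u → Mⱼ⊇ b b (≤-trans j≤pᵇ (m≤m+n (p ^ b) _)) j≤pᵇ (⊆-prodʳ ⟨⟩-isSubgroup u))
            where
              j≤pᵇ : j ≤ p ^ b
              j≤pᵇ = ≤*p⇒ceilDiv≤ (≡.subst (2 + n ≤_) (*-comm p (p ^ b)) 2+n≤pᵇ⁺¹)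

      M≐γ₂^·G^ : ∀ {n} a b → a ≤index[ 2 ] n → b ≤index[ 1 ] n → n ≤ 2 * p ^ a → n ≤ p ^ b →
                 M p n ≐ (γ₂^ p ^ a ·G^ p ^ b)
      M≐γ₂^·G^ {n} a b ia ib n≤2pᵃ n≤pᵇ =
        (λ _ → MAux⊆γ₂^·G^ n n ≤-refl a b ia ib) , (λ _ → γ₂^·G^⊆MAux n n ≤-refl a b n≤2pᵃ n≤pᵇ)

      M-lower-range : ∀ s i → 2 * p ^ s < i → i ≤ p ^ suc s → M p i ≐ (γ₂^ p ^ suc s ·G^ p ^ suc s)
      M-lower-range s i 2pˢ<i i≤pˢ⁺¹ =
        M≐γ₂^·G^ (suc s) (suc s) 2pˢ<i (≤-<-trans (*-monoˡ-≤ (p ^ s) (s≤s {0} {1} z≤n)) 2pˢ<i)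
                 (≤-trans i≤pˢ⁺¹ (m≤m+n _ _)) i≤pˢ⁺¹

      M-upper-range : ∀ s i → p ^ s < i → i ≤ 2 * p ^ s → M p i ≐ (γ₂^ p ^ s ·G^ p ^ suc s)
      M-upper-range s i pˢ<i i≤2pˢ =
        M≐γ₂^·G^ s (suc s) (2pᵃ≤index s pˢ<i) (≤-<-trans (≤-reflexive (*-identityˡ _)) pˢ<i)
                 i≤2pˢ (≤-trans i≤2pˢ (2pᵃ≤pᵃ⁺¹ s))
        where
          2pᵃ≤index : ∀ a → p ^ a < i → a ≤index[ 2 ] i
          2pᵃ≤index zero    _      = tt
          2pᵃ≤index (suc a) pᵃ⁺¹<i = ≤-<-trans (2pᵃ≤pᵃ⁺¹ a) pᵃ⁺¹<i

proposition3p1 : ∀ {c ℓ : Level} (p : ℕ) → Prime p → p ≢ 2 →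
    (G : Group c ℓ) → let open GroupDefs G in
    IsFinitePGroup p → TwoGenerated → ClassTwo →
    ∀ (s : ℕ) → 1 ≤ s → ∀ (i : ℕ) →
      ((2 * p ^ (s ∸ 1) + 1 ≤ i → i ≤ p ^ s →
          M p i ≐ prod (pow γ₂ (p ^ s)) (pow whole (p ^ s)))
      × (p ^ s + 1 ≤ i → i ≤ 2 * p ^ s →
          M p i ≐ prod (pow γ₂ (p ^ s)) (pow whole (p ^ (s + 1)))))
proposition3p1 zero          p-prime = ⊥-elim (¬prime[0] p-prime)
proposition3p1 (suc zero)    p-prime = ⊥-elim (¬prime[1] p-prime)
proposition3p1 (suc (suc q)) p-prime p≢2 G _ _ (class≤2 , _) (suc s) _ i =
    (λ 2pˢ+1≤i i≤pˢ⁺¹ → M-lower-range s i (+1≤⇒< 2pˢ+1≤i) i≤pˢ⁺¹)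
  , (λ pˢ⁺¹+1≤i i≤2pˢ⁺¹ → ≡.subst (λ b → M p i ≐ (γ₂^ p ^ suc s ·G^ p ^ b)) (+-comm 1 (suc s))
                              (M-upper-range (suc s) i (+1≤⇒< pˢ⁺¹+1≤i) i≤2pˢ⁺¹))
  where
    open GroupDefs G using (M; _≐_)
    open ClassAtMostTwo G class≤2
    open BrauerJenningsZassenhaus q (oddPrime∣C2 p-prime p≢2)

    +1≤⇒< : ∀ {m n} → m + 1 ≤ n → m < n
    +1≤⇒< {m} m+1≤n = ≤-trans (≤-reflexive (+-comm 1 m)) m+1≤n
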